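{- Let $T$ be a decomposition tree and $v$ an internal node of $T$. Suppose that (i) $\hat\gamma_0(v)=\widehat{\min}(v)+\hat\alpha(v)$; (ii) $\hat\gamma_{|\hat{TS}(v)|}(v)=\widehat{\min}(v)+|\hat{TS}(v)|-\hat\beta(v)$; and (iii) $\hat\gamma_{\hat\alpha(v)+2i}(v)=\widehat{\min}(v)$ for all integers $0\le i\le(\hat\beta(v)-\hat\alpha(v))/2$. Then for every $0\le k\le|\hat{TS}(v)|$: $\hat\gamma_k(v)=\widehat{\min}(v)+\hat\alpha(v)-k$ if $0\le k\le\hat\alpha(v)$; $\hat\gamma_k(v)=\widehat{\min}(v)+k-\hat\beta(v)$ if $\hat\beta(v)\le k\le|\hat{TS}(v)|$; $\hat\gamma_k(v)=\widehat{\min}(v)$ if $\hat\alpha(v)<k<\hat\beta(v)$ and $k-\hat\alpha(v)$ is even; and $\hat\gamma_k(v)=\widehat{\min}(v)+1$ otherwise.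
   Context: All graphs are finite, simple and undirected. For a graph $H$ and $S\subseteq V(H)$, $N_H[S]$ is the closed neighbourhood of $S$ in $H$ and $H[S]$ the induced subgraph; a graph with no vertices is regarded as having a (empty) perfect matching. A decomposition tree is a rooted tree $T$ in which every internal node has exactly two children, a left child $v_l$ and a right child $v_r$, and carries one of the labels $\otimes$ (true twin), $\odot$ (false twin), $\oplus$ (attachment). To each node $v$ are associated a graph $\hat G(v)$ and a twin set $\hat{TS}(v)\subseteq V(\hat G(v))$: for a leaf, $\hat G(v)$ is a single vertex $x$ (distinct leaves giving distinct vertices) and $\hat{TS}(v)=\{x\}$; for an internal node $v$, $V(\hat G(v))=V(\hat G(v_l))\cup V(\hat G(v_r))$ and: if $v$ is labeled $\otimes$, $E(\hat G(v))=E(\hat G(v_l))\cup E(\hat G(v_r))\cup\{xy: x\in \hat{TS}(v_l), y\in\hat{TS}(v_r)\}$ and $\hat{TS}(v)=\hat{TS}(v_l)\cup\hat{TS}(v_r)$; if labeled $\odot$, $E(\hat G(v))=E(\hat G(v_l))\cup E(\hat G(v_r))$ and $\hat{TS}(v)=\hat{TS}(v_l)\cup\hat{TS}(v_r)$; if labeled $\oplus$, the edge set is as for $\otimes$ and $\hat{TS}(v)=\hat{TS}(v_l)$. For $0\le k\le|\hat{TS}(v)|$, $\hat\gamma_k(v)$ is the minimum of $|S|$ over all $S\subseteq V(\hat G(v))$ with $V(\hat G(v))\setminus \hat{TS}(v)\subseteq N_{\hat G(v)}[S]$ for which there is $X\subseteq S\cap\hat{TS}(v)$, $|X|=k$, such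 that $\hat G(v)[S\setminus X]$ has a perfect matching. Let $\widehat{\min}(v)=\min\{\hat\gamma_k(v):0\le k\le|\hat{TS}(v)|\}$, and let $\hat\alpha(v)$ (resp. $\hat\beta(v)$) be the smallest (resp. largest) $k$ with $\hat\gamma_k(v)=\widehat{\min}(v)$. -}

module Defs where

open import Data.Nat using (ℕ; zero; suc; _+_; _*_; _∸_; _≤_; _<_)
open import Data.Nat.Divisibility using (_∣_)
open import Data.Fin using (Fin; splitAt)
open import Data.Fin.Subset using (Subset; inside; outside; _∈_; _∉_; _⊆_; _∩_; _─_; ∣_∣)
open import Data.Vec using ([]; _∷_; _++_; replicate)
open import Data.Sum using (_⊎_; inj₁; inj₂)
open import Data.Product using (Σ; _×_; ∃; ∃-syntax)
open import Data.Unit using (⊤)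
open import Data.Empty using (⊥)
open import Relation.Binary.PropositionalEquality using (_≡_)
open import Relation.Nullary using (¬_)

-- Node labels: ⊗ (true twin), ⊙ (false twin), ⊕ (attachment)
data Label : Set where
  ⊗ ⊙ ⊕ : Label

data Tree : Set where
  leaf : Tree
  node : Label → Tree → Tree → Tree

data _≼_ : Tree → Tree → Set where
  here  : ∀ {t} → t ≼ t
  left  : ∀ {t ℓ l r} → t ≼ l → t ≼ node ℓ l r
  right : ∀ {t ℓ l r} → t ≼ r → t ≼ node ℓ l r

-- number of vertices of Ĝ(v) = number of leaves below v.
-- Vertices of Ĝ(node ℓ l r) are Fin (size l + size r): first the
-- vertices of Ĝ(l), then those of Ĝ(r).
size : Tree → ℕ
size leaf = 1
size (node _ l r) = size l + size r

TS : (t : Tree) → Subset (size t)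
TS leaf = inside ∷ []
TS (node ⊗ l r) = TS l ++ TS r
TS (node ⊙ l r) = TS l ++ TS r
TS (node ⊕ l r) = TS l ++ replicate (size r) outside

-- whether the label adds all edges between TŜ(v_l) and TŜ(v_r)
Cross : Label → Set
Cross ⊗ = ⊤
Cross ⊙ = ⊥
Cross ⊕ = ⊤

mutual
  Adj : (t : Tree) → Fin (size t) → Fin (size t) → Set
  Adj leaf _ _ = ⊥
  Adj (node ℓ l r) i j = AdjS ℓ l r (splitAt (size l) i) (splitAt (size l) j)

  AdjS : Label → (l r : Tree) → Fin (size l) ⊎ Fin (size r) → Fin (size l) ⊎ Fin (size r) → Set
  AdjS ℓ l r (inj₁ a) (inj₁ b) = Adj l a b
  AdjS ℓ l r (inj₂ a) (inj₂ b) = Adj r a b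
  AdjS ℓ l r (inj₁ a) (inj₂ b) = Cross ℓ × (a ∈ TS l) × (b ∈ TS r)
  AdjS ℓ l r (inj₂ a) (inj₁ b) = Cross ℓ × (b ∈ TS l) × (a ∈ TS r)

Dominates : (t : Tree) → Subset (size t) → Set
Dominates t S = ∀ u → u ∉ TS t → (u ∈ S) ⊎ (∃[ w ] (w ∈ S × Adj t u w))

-- Ĝ(v)[U] has a perfect matching, given by the partner map m
-- (a fixed-point-free involution of U along edges of Ĝ(v)).
HasPerfectMatching : (t : Tree) → Subset (size t) → Set
HasPerfectMatching t U =
  Σ (Fin (size t) → Fin (size t)) λ m →
    ∀ u → u ∈ U → (m u ∈ U) × Adj t u (m u) × (m (m u) ≡ u)

Feasible : (t : Tree) → ℕ → Subset (size t) → Set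
Feasible t k S =
  Dominates t S ×
  (∃[ X ] ((X ⊆ S ∩ TS t) × (∣ X ∣ ≡ k) × HasPerfectMatching t (S ─ X)))

IsGamma : (t : Tree) → ℕ → ℕ → Set
IsGamma t k m =
  (∃[ S ] (Feasible t k S × ∣ S ∣ ≡ m)) ×
  (∀ S → Feasible t k S → m ≤ ∣ S ∣)

nTS : Tree → ℕ
nTS t = ∣ TS t ∣

IsMinHat : Tree → ℕ → Set
IsMinHat t μ =
  (∃[ k ] (k ≤ nTS t × IsGamma t k μ)) ×
  (∀ k → k ≤ nTS t → ∀ S → Feasible t k S → μ ≤ ∣ S ∣)

IsAlphaHat : Tree → ℕ → Set
IsAlphaHat t a =
  Σ ℕ λ μ → IsMinHat t μ × a ≤ nTS t × IsGamma t a μ ×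
    (∀ k → k < a → ¬ IsGamma t k μ)

IsBetaHat : Tree → ℕ → Set
IsBetaHat t b =
  Σ ℕ λ μ → IsMinHat t μ × b ≤ nTS t × IsGamma t b μ ×
    (∀ k → b < k → k ≤ nTS t → ¬ IsGamma t k μ)

{-# OPTIONS --safe #-}
-- Write γ_k for γ̂_k(v) and n for |TŜ(v)|.  Then |γ_k − γ_{k+1}| ≤ 1.  Going from k+1 to k, take
-- x out of X; going from k < n to k+1, put a twin x ∉ X into X, adding it to S if x ∉ S, and
-- otherwise unmatching its partner.  The one vertex left without a partner is then matched to
-- a neighbour outside S, or, if it has none, deleted from S.  Moreover |S| − k = |S ∖ X| is
-- even for every admissible S, so γ_k ≡ k (mod 2).  With γ known at 0, α̂, β̂, n and on α̂ + 2ℕ,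
-- the Lipschitz bound gives the two slopes, and parity forbids the value min̂ at odd offsets
-- from α̂, where min̂ + 1 is attained one step after α̂ + 2ℕ.
module Submission where

open import Defs
open import Data.Nat using (ℕ; zero; suc; _+_; _*_; _∸_; _≤_; _<_; z≤n; s≤s)
open import Data.Nat.Properties
  using ( suc-injective; +-suc; +-assoc; +-comm; *-comm; +-cancelˡ-≡; +-cancelˡ-≤
        ; ≤-refl; ≤-reflexive; ≤-trans; ≤-antisym; <-trans; <⇒≤; <⇒≱; ≤∧≢⇒<; n<1+n
        ; m≤n⇒m≤1+n; m≤n+m; ∸-monoˡ-≤; m≤n+o⇒m∸n≤o; +-∸-assoc; +-∸-comm; m+[n∸m]≡n; m∸n+n≡m )
open import Data.Nat.Divisibility using (_∣_; divides; _∣0; n∣n; ∣m∣n⇒∣m+n; ∣m+n∣m⇒∣n)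
open import Data.Fin using (Fin; zero; suc; splitAt; _≟_)
open import Data.Fin.Properties using (any?)
open import Data.Fin.Subset
open import Data.Fin.Subset.Properties
open import Data.Vec using ([]; _∷_; here; there)
open import Data.Product using (_×_; _,_; ∃-syntax; proj₁; proj₂; map₁)
open import Data.Sum as Sum using (_⊎_; inj₁; inj₂)
open import Data.Unit using (tt)
open import Function using (_∘_)
open import Relation.Binary.PropositionalEquality
open import Relation.Nullary using (¬_; Dec; yes; no; contradiction; ¬?; _×-dec_)
open import Relation.Nullary.Decidable using (decidable-stable)

private variable n : ℕ

x∈p─q⇒x∉q : ∀ (p q : Subset n) {x} → x ∈ p ─ q → x ∉ q
x∈p─q⇒x∉q (_ ∷ p) (outside ∷ q) here      ()
x∈p─q⇒x∉q (_ ∷ p) (_ ∷ q)       (there x∈) (there x∈q) = x∈p─q⇒x∉q p q x∈ x∈q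

x∉p-x : ∀ (p : Subset n) x → x ∉ p - x
x∉p-x p x x∈p-x = x∈p─q⇒x∉q p ⁅ x ⁆ x∈p-x (x∈⁅x⁆ x)

x∈p-y⇒x≢y : ∀ {p : Subset n} {x y} → x ∈ p - y → x ≢ y
x∈p-y⇒x≢y {p = p} {y = y} x∈p-y = x∉⁅y⁆⇒x≢y (x∈p─q⇒x∉q p ⁅ y ⁆ x∈p-y)

x∈p∧y∉p⇒x≢y : ∀ {p : Subset n} {x y} → x ∈ p → y ∉ p → x ≢ y
x∈p∧y∉p⇒x≢y x∈p y∉p refl = y∉p x∈p

∣p∪⁅x⁆∣≡1+∣p∣ : ∀ (p : Subset n) {x} → x ∉ p → ∣ p ∪ ⁅ x ⁆ ∣ ≡ suc ∣ p ∣
∣p∪⁅x⁆∣≡1+∣p∣ (inside  ∷ p) {zero}  x∉p = contradiction here x∉p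
∣p∪⁅x⁆∣≡1+∣p∣ (outside ∷ p) {zero}  x∉p = cong (λ q → suc ∣ q ∣) (∪-identityʳ p)
∣p∪⁅x⁆∣≡1+∣p∣ (inside  ∷ p) {suc x} x∉p = cong suc (∣p∪⁅x⁆∣≡1+∣p∣ p (x∉p ∘ there))
∣p∪⁅x⁆∣≡1+∣p∣ (outside ∷ p) {suc x} x∉p = ∣p∪⁅x⁆∣≡1+∣p∣ p (x∉p ∘ there)

p-x∪⁅x⁆≡p : ∀ (p : Subset n) {x} → x ∈ p → (p - x) ∪ ⁅ x ⁆ ≡ p
p-x∪⁅x⁆≡p (inside  ∷ p) {zero}  here        = cong (inside ∷_) (trans (∪-identityʳ (p ─ ⊥)) (p─⊥≡p p))
p-x∪⁅x⁆≡p (inside  ∷ p) {suc x} (there x∈p) = cong (inside ∷_) (p-x∪⁅x⁆≡p p x∈p)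
p-x∪⁅x⁆≡p (outside ∷ p) {suc x} (there x∈p) = cong (outside ∷_) (p-x∪⁅x⁆≡p p x∈p)

p∪⁅x⁆─q∪⁅x⁆≡p─q : ∀ (p q : Subset n) {x} → x ∉ p → (p ∪ ⁅ x ⁆) ─ (q ∪ ⁅ x ⁆) ≡ p ─ q
p∪⁅x⁆─q∪⁅x⁆≡p─q (inside  ∷ p) _             {zero}  x∉p = contradiction here x∉p
p∪⁅x⁆─q∪⁅x⁆≡p─q (outside ∷ p) (inside  ∷ q) {zero}  _   =
  cong (outside ∷_) (cong₂ _─_ (∪-identityʳ p) (∪-identityʳ q))
p∪⁅x⁆─q∪⁅x⁆≡p─q (outside ∷ p) (outside ∷ q) {zero}  _   =
  cong (outside ∷_) (cong₂ _─_ (∪-identityʳ p) (∪-identityʳ q))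
p∪⁅x⁆─q∪⁅x⁆≡p─q (s       ∷ p) (inside  ∷ q) {suc x} x∉p =
  cong (outside ∷_) (p∪⁅x⁆─q∪⁅x⁆≡p─q p q (x∉p ∘ there))
p∪⁅x⁆─q∪⁅x⁆≡p─q (inside  ∷ p) (outside ∷ q) {suc x} x∉p =
  cong (inside ∷_) (p∪⁅x⁆─q∪⁅x⁆≡p─q p q (x∉p ∘ there))
p∪⁅x⁆─q∪⁅x⁆≡p─q (outside ∷ p) (outside ∷ q) {suc x} x∉p =
  cong (outside ∷_) (p∪⁅x⁆─q∪⁅x⁆≡p─q p q (x∉p ∘ there))

p∪⁅x⁆─q≡p─q∪⁅x⁆ : ∀ (p q : Subset n) {x} → x ∉ q → (p ∪ ⁅ x ⁆) ─ q ≡ (p ─ q) ∪ ⁅ x ⁆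
p∪⁅x⁆─q≡p─q∪⁅x⁆ _             (inside  ∷ q) {zero}  x∉q = contradiction here x∉q
p∪⁅x⁆─q≡p─q∪⁅x⁆ (inside  ∷ p) (outside ∷ q) {zero}  _   =
  cong (inside ∷_) (trans (cong (_─ q) (∪-identityʳ p)) (sym (∪-identityʳ (p ─ q))))
p∪⁅x⁆─q≡p─q∪⁅x⁆ (outside ∷ p) (outside ∷ q) {zero}  _   =
  cong (inside ∷_) (trans (cong (_─ q) (∪-identityʳ p)) (sym (∪-identityʳ (p ─ q))))
p∪⁅x⁆─q≡p─q∪⁅x⁆ (s       ∷ p) (inside  ∷ q) {suc x} x∉q =
  cong (outside ∷_) (p∪⁅x⁆─q≡p─q∪⁅x⁆ p q (x∉q ∘ there))
p∪⁅x⁆─q≡p─q∪⁅x⁆ (inside  ∷ p) (outside ∷ q) {suc x} x∉q =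
  cong (inside ∷_) (p∪⁅x⁆─q≡p─q∪⁅x⁆ p q (x∉q ∘ there))
p∪⁅x⁆─q≡p─q∪⁅x⁆ (outside ∷ p) (outside ∷ q) {suc x} x∉q =
  cong (outside ∷_) (p∪⁅x⁆─q≡p─q∪⁅x⁆ p q (x∉q ∘ there))

∣p-x∣+1≡∣p∣ : ∀ (p : Subset n) {x} → x ∈ p → suc ∣ p - x ∣ ≡ ∣ p ∣
∣p-x∣+1≡∣p∣ p {x} x∈p = begin
  suc ∣ p - x ∣          ≡⟨ ∣p∪⁅x⁆∣≡1+∣p∣ (p - x) (x∉p-x p x) ⟨
  ∣ (p - x) ∪ ⁅ x ⁆ ∣    ≡⟨ cong ∣_∣ (p-x∪⁅x⁆≡p p x∈p) ⟩
  ∣ p ∣                  ∎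
  where open ≡-Reasoning

∣p∣≡∣q∣+∣p─q∣ : ∀ (p q : Subset n) → q ⊆ p → ∣ p ∣ ≡ ∣ q ∣ + ∣ p ─ q ∣
∣p∣≡∣q∣+∣p─q∣ []            []            q⊆p = refl
∣p∣≡∣q∣+∣p─q∣ (inside  ∷ p) (inside  ∷ q) q⊆p = cong suc (∣p∣≡∣q∣+∣p─q∣ p q (drop-∷-⊆ q⊆p))
∣p∣≡∣q∣+∣p─q∣ (inside  ∷ p) (outside ∷ q) q⊆p =
  trans (cong suc (∣p∣≡∣q∣+∣p─q∣ p q (drop-∷-⊆ q⊆p))) (sym (+-suc ∣ q ∣ ∣ p ─ q ∣))
∣p∣≡∣q∣+∣p─q∣ (outside ∷ p) (inside  ∷ q) q⊆p = contradiction (q⊆p here) λ ()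
∣p∣≡∣q∣+∣p─q∣ (outside ∷ p) (outside ∷ q) q⊆p = ∣p∣≡∣q∣+∣p─q∣ p q (drop-∷-⊆ q⊆p)

∣p∣≡1+k⇒Nonempty : ∀ (p : Subset n) {k} → ∣ p ∣ ≡ suc k → Nonempty p
∣p∣≡1+k⇒Nonempty (inside  ∷ p) _ = zero , here
∣p∣≡1+k⇒Nonempty (outside ∷ p) e with ∣p∣≡1+k⇒Nonempty p e
... | x , x∈p = suc x , there x∈p

∩-monoˡ-⊆ : ∀ {p q : Subset n} r → p ⊆ q → p ∩ r ⊆ q ∩ r
∩-monoˡ-⊆ {p = p} r p⊆q = x∈p∩q⁺ ∘ map₁ p⊆q ∘ x∈p∩q⁻ p r

p⊆q∩r⇒p⊆q-x∩r : ∀ {p q r : Subset n} {x} → p ⊆ q ∩ r → x ∉ p → p ⊆ (q - x) ∩ r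
p⊆q∩r⇒p⊆q-x∩r {q = q} {r} p⊆q∩r x∉p z∈p =
  x∈p∩q⁺ (map₁ (λ z∈q → x∈p∧x≢y⇒x∈p-y z∈q (x∈p∧y∉p⇒x≢y z∈p x∉p)) (x∈p∩q⁻ q r (p⊆q∩r z∈p)))

p⊆r⇒p∪⁅x⁆⊆r : ∀ {p r : Subset n} {x} → p ⊆ r → x ∈ r → p ∪ ⁅ x ⁆ ⊆ r
p⊆r⇒p∪⁅x⁆⊆r {p = p} {x = x} p⊆r x∈r z∈ with x∈p∪q⁻ p ⁅ x ⁆ z∈
... | inj₁ z∈p   = p⊆r z∈p
... | inj₂ z∈⁅x⁆ rewrite x∈⁅y⁆⇒x≡y x z∈⁅x⁆ = x∈r

∣q∣<∣p∣⇒Nonempty[p─q] : ∀ (p q : Subset n) → ∣ q ∣ < ∣ p ∣ → Nonempty (p ─ q)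
∣q∣<∣p∣⇒Nonempty[p─q] p q ∣q∣<∣p∣ with nonempty? (p ─ q)
... | yes p─q≢∅ = p─q≢∅
... | no  p─q≡∅ = contradiction (p⊆q⇒∣p∣≤∣q∣ p⊆q) (<⇒≱ ∣q∣<∣p∣)
  where
  p⊆q : p ⊆ q
  p⊆q {z} z∈p = decidable-stable (z ∈? q) λ z∉q → p─q≡∅ (z , x∈p∧x∉q⇒x∈p─q z∈p z∉q)

cross? : ∀ ℓ → Dec (Cross ℓ)
cross? ⊗ = yes tt
cross? ⊙ = no λ ()
cross? ⊕ = yes tt

mutual
  adj? : ∀ t i j → Dec (Adj t i j)
  adj? leaf         i j = no λ ()
  adj? (node ℓ l r) i j = adjS? ℓ l r (splitAt (size l) i) (splitAt (size l) j)

  adjS? : ∀ ℓ l r x y → Dec (AdjS ℓ l r x y)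
  adjS? ℓ l r (inj₁ a) (inj₁ b) = adj? l a b
  adjS? ℓ l r (inj₂ a) (inj₂ b) = adj? r a b
  adjS? ℓ l r (inj₁ a) (inj₂ b) = cross? ℓ ×-dec (a ∈? TS l) ×-dec (b ∈? TS r)
  adjS? ℓ l r (inj₂ a) (inj₁ b) = cross? ℓ ×-dec (b ∈? TS l) ×-dec (a ∈? TS r)

mutual
  adj-sym : ∀ t {i j} → Adj t i j → Adj t j i
  adj-sym leaf         ()
  adj-sym (node ℓ l r) {i} {j} = adjS-sym ℓ l r (splitAt (size l) i) (splitAt (size l) j)

  adjS-sym : ∀ ℓ l r x y → AdjS ℓ l r x y → AdjS ℓ l r y x
  adjS-sym ℓ l r (inj₁ a) (inj₁ b) = adj-sym l
  adjS-sym ℓ l r (inj₂ a) (inj₂ b) = adj-sym r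
  adjS-sym ℓ l r (inj₁ a) (inj₂ b) e = e
  adjS-sym ℓ l r (inj₂ a) (inj₁ b) e = e

mutual
  adj-irrefl : ∀ t i → ¬ Adj t i i
  adj-irrefl leaf         i ()
  adj-irrefl (node ℓ l r) i = adjS-irrefl ℓ l r (splitAt (size l) i)

  adjS-irrefl : ∀ ℓ l r x → ¬ AdjS ℓ l r x x
  adjS-irrefl ℓ l r (inj₁ a) = adj-irrefl l a
  adjS-irrefl ℓ l r (inj₂ a) = adj-irrefl r a

adj⇒≢ : ∀ t {i j} → Adj t i j → i ≢ j
adj⇒≢ t {i} e refl = adj-irrefl t i e

neighbour-outside? : ∀ t (S : Subset (size t)) x →
  (∃[ y ] (y ∉ S × Adj t x y)) ⊎ (∀ y → Adj t x y → y ∈ S)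
neighbour-outside? t S x with any? (λ y → ¬? (y ∈? S) ×-dec adj? t x y)
... | yes out = inj₁ out
... | no ¬out = inj₂ λ y xy → decidable-stable (y ∈? S) λ y∉S → ¬out (y , y∉S , xy)

IsPerfectMatching : (t : Tree) → (Fin (size t) → Fin (size t)) → Subset (size t) → Set
IsPerfectMatching t m U = ∀ u → u ∈ U → (m u ∈ U) × Adj t u (m u) × (m (m u) ≡ u)

link : ∀ {n} → (Fin n → Fin n) → Fin n → Fin n → Fin n → Fin n
link m x y z with z ≟ x | z ≟ y
... | yes _ | _     = y
... | no _  | yes _ = x
... | no _  | no _  = m z

module _ {n} (m : Fin n → Fin n) (x y : Fin n) where

  link-x : link m x y x ≡ y
  link-x with x ≟ x
  ... | yes _   = refl
  ... | no x≢x = contradiction refl x≢x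

  link-y : x ≢ y → link m x y y ≡ x
  link-y x≢y with y ≟ x | y ≟ y
  ... | yes y≡x | _       = contradiction (sym y≡x) x≢y
  ... | no _    | yes _   = refl
  ... | no _    | no y≢y = contradiction refl y≢y

  link-other : ∀ {z} → z ≢ x → z ≢ y → link m x y z ≡ m z
  link-other {z} z≢x z≢y with z ≟ x | z ≟ y
  ... | yes z≡x | _       = contradiction z≡x z≢x
  ... | no _    | yes z≡y = contradiction z≡y z≢y
  ... | no _    | no _    = refl

module _ (t : Tree) {m : Fin (size t) → Fin (size t)} {U : Subset (size t)}
         (M : IsPerfectMatching t m U) where

  matching-remove-pair : ∀ {u} → u ∈ U → IsPerfectMatching t m (U - u - m u)
  matching-remove-pair {u} u∈U z z∈ =
    x∈p∧x≢y⇒x∈p-y (x∈p∧x≢y⇒x∈p-y mz∈U mz≢u) mz≢mu , z~mz , mmz≡z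
    where
    z∈U-u = p─q⊆p _ _ z∈
    z≢u = x∈p-y⇒x≢y z∈U-u
    z≢mu = x∈p-y⇒x≢y z∈
    Mz = M z (p─q⊆p _ _ z∈U-u)
    mz∈U = proj₁ Mz
    z~mz = proj₁ (proj₂ Mz)
    mmz≡z = proj₂ (proj₂ Mz)
    mz≢u : m z ≢ u
    mz≢u mz≡u = z≢mu (trans (sym mmz≡z) (cong m mz≡u))
    mz≢mu : m z ≢ m u
    mz≢mu mz≡mu = z≢u (trans (sym mmz≡z) (trans (cong m mz≡mu) (proj₂ (proj₂ (M u u∈U)))))

  ∣U-u-mu∣+2≡∣U∣ : ∀ {u} → u ∈ U → suc (suc ∣ U - u - m u ∣) ≡ ∣ U ∣
  ∣U-u-mu∣+2≡∣U∣ {u} u∈U = trans (cong suc (∣p-x∣+1≡∣p∣ (U - u) mu∈U-u)) (∣p-x∣+1≡∣p∣ U u∈U)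
    where
    Mu = M u u∈U
    mu∈U-u = x∈p∧x≢y⇒x∈p-y (proj₁ Mu) (adj⇒≢ t (adj-sym t (proj₁ (proj₂ Mu))))

  module _ {x y} (x∉U : x ∉ U) (y∉U : y ∉ U) (x~y : Adj t x y) where

    private
      x≢y = adj⇒≢ t x~y

      x∈U′ : x ∈ (U ∪ ⁅ x ⁆) ∪ ⁅ y ⁆
      x∈U′ = x∈p∪q⁺ (inj₁ (x∈p∪q⁺ (inj₂ (x∈⁅x⁆ x))))

      y∈U′ : y ∈ (U ∪ ⁅ x ⁆) ∪ ⁅ y ⁆
      y∈U′ = x∈p∪q⁺ (inj₂ (x∈⁅x⁆ y))

      U⊆U′ : U ⊆ (U ∪ ⁅ x ⁆) ∪ ⁅ y ⁆
      U⊆U′ z∈U = x∈p∪q⁺ (inj₁ (x∈p∪q⁺ (inj₁ z∈U)))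

    matching-add-edge : IsPerfectMatching t (link m x y) ((U ∪ ⁅ x ⁆) ∪ ⁅ y ⁆)
    matching-add-edge z z∈ with x∈p∪q⁻ (U ∪ ⁅ x ⁆) ⁅ y ⁆ z∈
    ... | inj₂ z∈⁅y⁆ rewrite x∈⁅y⁆⇒x≡y y z∈⁅y⁆ | link-y m x y x≢y | link-x m x y =
      x∈U′ , adj-sym t x~y , refl
    ... | inj₁ z∈U∪⁅x⁆ with x∈p∪q⁻ U ⁅ x ⁆ z∈U∪⁅x⁆
    ... | inj₂ z∈⁅x⁆ rewrite x∈⁅y⁆⇒x≡y x z∈⁅x⁆ | link-x m x y | link-y m x y x≢y =
      y∈U′ , x~y , refl
    ... | inj₁ z∈U with M z z∈U
    ... | mz∈U , z~mz , mmz≡z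
      rewrite link-other m x y (x∈p∧y∉p⇒x≢y z∈U x∉U) (x∈p∧y∉p⇒x≢y z∈U y∉U)
            | link-other m x y (x∈p∧y∉p⇒x≢y mz∈U x∉U) (x∈p∧y∉p⇒x≢y mz∈U y∉U) =
      U⊆U′ mz∈U , z~mz , mmz≡z

matching-even-size : ∀ t {m} c {U} → ∣ U ∣ ≡ c → IsPerfectMatching t m U → 2 ∣ c
matching-even-size t zero    _          _ = 2 ∣0
matching-even-size t {m} (suc c) {U} ∣U∣≡1+c M with ∣p∣≡1+k⇒Nonempty U ∣U∣≡1+c
... | u , u∈U = pair-removed c (trans (∣U-u-mu∣+2≡∣U∣ t M u∈U) ∣U∣≡1+c) (matching-remove-pair t M u∈U)
  where
  pair-removed : ∀ c {U₂} → suc (suc ∣ U₂ ∣) ≡ suc c → IsPerfectMatching t m U₂ → 2 ∣ suc c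
  pair-removed zero    ()
  pair-removed (suc c) e M₂ = ∣m∣n⇒∣m+n n∣n (matching-even-size t c (suc-injective (suc-injective e)) M₂)

perfectMatching-even : ∀ t {U} → HasPerfectMatching t U → 2 ∣ ∣ U ∣
perfectMatching-even t (m , M) = matching-even-size t _ refl M

DominatedBy : (t : Tree) → Subset (size t) → Fin (size t) → Set
DominatedBy t S u = u ∈ S ⊎ ∃[ w ] (w ∈ S × Adj t u w)

-- The state halfway through changing k by one: x has lost its partner and awaits repair.
record FeasibleExcept (t : Tree) (k : ℕ) (S : Subset (size t)) (x : Fin (size t)) : Set where
  field
    dominates   : Dominates t S
    x∈S         : x ∈ S
    x-dominated : x ∉ TS t → DominatedBy t (S - x) x
    X           : Subset (size t)
    X⊆S-x∩TS    : X ⊆ (S - x) ∩ TS t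
    ∣X∣≡k       : ∣ X ∣ ≡ k
    matched     : HasPerfectMatching t (S ─ X - x)

GammaAtMost : Tree → ℕ → ℕ → Set
GammaAtMost t k m = ∃[ S ] (Feasible t k S × ∣ S ∣ ≤ m)

module _ (t : Tree) where

  dominates-mono : ∀ {S S′} → S ⊆ S′ → Dominates t S → Dominates t S′
  dominates-mono S⊆S′ dom u u∉TS =
    Sum.map S⊆S′ (λ (w , w∈S , u~w) → w , S⊆S′ w∈S , u~w) (dom u u∉TS)

  dominates-remove : ∀ {S x} → Dominates t S → (∀ y → Adj t x y → y ∈ S) →
    (x ∉ TS t → DominatedBy t (S - x) x) → Dominates t (S - x)
  dominates-remove {S} {x} dom N[x]⊆S x-dominated u u∉TS with u ≟ x
  ... | yes refl = x-dominated u∉TS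
  ... | no u≢x with dom u u∉TS
  ...   | inj₁ u∈S = inj₁ (x∈p∧x≢y⇒x∈p-y u∈S u≢x)
  ...   | inj₂ (w , w∈S , u~w) with w ≟ x
  ...     | yes refl = inj₁ (x∈p∧x≢y⇒x∈p-y (N[x]⊆S u (adj-sym t u~w)) u≢x)
  ...     | no w≢x   = inj₂ (w , x∈p∧x≢y⇒x∈p-y w∈S w≢x , u~w)

  feasibleExcept-extend : ∀ {k S x y} → FeasibleExcept t k S x → y ∉ S → Adj t x y →
    Feasible t k (S ∪ ⁅ y ⁆)
  feasibleExcept-extend {S = S} {x} {y} F y∉S x~y =
    dominates-mono (p⊆p∪q _) dominates , X ,
    ∩-monoˡ-⊆ (TS t) (p⊆p∪q _ ∘ p─q⊆p S ⁅ x ⁆) ∘ X⊆S-x∩TS , ∣X∣≡k ,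
    link m x y , subst (IsPerfectMatching t (link m x y)) (sym S∪⁅y⁆─X≡) M′
    where
    open FeasibleExcept F
    m = proj₁ matched
    x∈S─X : x ∈ S ─ X
    x∈S─X = x∈p∧x∉q⇒x∈p─q x∈S λ x∈X → x∉p-x S x (proj₁ (x∈p∩q⁻ _ _ (X⊆S-x∩TS x∈X)))
    y∉X : y ∉ X
    y∉X = y∉S ∘ p─q⊆p S ⁅ x ⁆ ∘ proj₁ ∘ x∈p∩q⁻ _ _ ∘ X⊆S-x∩TS
    S∪⁅y⁆─X≡ : (S ∪ ⁅ y ⁆) ─ X ≡ ((S ─ X - x) ∪ ⁅ x ⁆) ∪ ⁅ y ⁆
    S∪⁅y⁆─X≡ = trans (p∪⁅x⁆─q≡p─q∪⁅x⁆ S X y∉X) (cong (_∪ ⁅ y ⁆) (sym (p-x∪⁅x⁆≡p (S ─ X) x∈S─X)))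
    M′ = matching-add-edge t (proj₂ matched) (x∉p-x (S ─ X) x) (y∉S ∘ p─q⊆p S X ∘ p─q⊆p (S ─ X) ⁅ x ⁆) x~y

  feasibleExcept-drop : ∀ {k S x} → FeasibleExcept t k S x → (∀ y → Adj t x y → y ∈ S) →
    Feasible t k (S - x)
  feasibleExcept-drop {S = S} {x} F N[x]⊆S =
    dominates-remove dominates N[x]⊆S x-dominated , X , X⊆S-x∩TS , ∣X∣≡k ,
    subst (HasPerfectMatching t) (sym (p─q─r≡p─r─q S ⁅ x ⁆ X)) matched
    where open FeasibleExcept F

  feasibleExcept⇒gammaAtMost : ∀ {k S x} → FeasibleExcept t k S x → GammaAtMost t k (suc ∣ S ∣)
  feasibleExcept⇒gammaAtMost {S = S} {x} F with neighbour-outside? t S x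
  ... | inj₁ (y , y∉S , x~y) =
    S ∪ ⁅ y ⁆ , feasibleExcept-extend F y∉S x~y , ≤-reflexive (∣p∪⁅x⁆∣≡1+∣p∣ S y∉S)
  ... | inj₂ N[x]⊆S =
    S - x , feasibleExcept-drop F N[x]⊆S , m≤n⇒m≤1+n (∣p─q∣≤∣p∣ S ⁅ x ⁆)

  feasible-unmatch : ∀ {k S} → Feasible t (suc k) S → ∃[ x ] FeasibleExcept t k S x
  feasible-unmatch {k} {S} (dom , X , X⊆S∩TS , ∣X∣≡1+k , M) with ∣p∣≡1+k⇒Nonempty X ∣X∣≡1+k
  ... | x , x∈X = x , record
    { dominates   = dom
    ; x∈S         = proj₁ x∈S∩TS
    ; x-dominated = contradiction (proj₂ x∈S∩TS)
    ; X           = X - x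
    ; X⊆S-x∩TS    = p⊆q∩r⇒p⊆q-x∩r (X⊆S∩TS ∘ p─q⊆p X ⁅ x ⁆) (x∉p-x X x)
    ; ∣X∣≡k       = suc-injective (trans (∣p-x∣+1≡∣p∣ X x∈X) ∣X∣≡1+k)
    ; matched     = subst (HasPerfectMatching t) S─X≡ M
    }
    where
    x∈S∩TS = x∈p∩q⁻ S (TS t) (X⊆S∩TS x∈X)
    S─X≡ : S ─ X ≡ S ─ (X - x) - x
    S─X≡ = trans (cong (S ─_) (sym (p-x∪⁅x⁆≡p X x∈X))) (sym (p─q─r≡p─q∪r S (X - x) ⁅ x ⁆))

  feasible-add-twin : ∀ {k S x} → Feasible t k S → x ∈ TS t → x ∉ S → Feasible t (suc k) (S ∪ ⁅ x ⁆)
  feasible-add-twin {S = S} {x} (dom , X , X⊆S∩TS , ∣X∣≡k , M) x∈TS x∉S =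
    dominates-mono (p⊆p∪q _) dom , X ∪ ⁅ x ⁆ ,
    p⊆r⇒p∪⁅x⁆⊆r (∩-monoˡ-⊆ (TS t) (p⊆p∪q _) ∘ X⊆S∩TS) (x∈p∩q⁺ (q⊆p∪q S ⁅ x ⁆ (x∈⁅x⁆ x) , x∈TS)) ,
    trans (∣p∪⁅x⁆∣≡1+∣p∣ X x∉X) (cong suc ∣X∣≡k) ,
    subst (HasPerfectMatching t) (sym (p∪⁅x⁆─q∪⁅x⁆≡p─q S X x∉S)) M
    where
    x∉X = x∉S ∘ proj₁ ∘ x∈p∩q⁻ S (TS t) ∘ X⊆S∩TS

  partner-unmatched : ∀ {k S X m x} → Dominates t S → X ⊆ S ∩ TS t → ∣ X ∣ ≡ k →
    IsPerfectMatching t m (S ─ X) → x ∈ TS t → x ∈ S ─ X → FeasibleExcept t (suc k) S (m x)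
  partner-unmatched {S = S} {X} {m} {x} dom X⊆S∩TS ∣X∣≡k M x∈TS x∈S─X = record
    { dominates   = dom
    ; x∈S         = p─q⊆p S X mx∈S─X
    ; x-dominated = λ _ → inj₂ (x , x∈S-mx , adj-sym t x~mx)
    ; X           = X ∪ ⁅ x ⁆
    ; X⊆S-x∩TS    = p⊆r⇒p∪⁅x⁆⊆r (p⊆q∩r⇒p⊆q-x∩r X⊆S∩TS (x∈p─q⇒x∉q S X mx∈S─X)) (x∈p∩q⁺ (x∈S-mx , x∈TS))
    ; ∣X∣≡k       = trans (∣p∪⁅x⁆∣≡1+∣p∣ X (x∈p─q⇒x∉q S X x∈S─X)) (cong suc ∣X∣≡k)
    ; matched     = m , subst (IsPerfectMatching t m) (cong (_- m x) (p─q─r≡p─q∪r S X ⁅ x ⁆))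
                              (matching-remove-pair t M x∈S─X)
    }
    where
    mx∈S─X = proj₁ (M x x∈S─X)
    x~mx = proj₁ (proj₂ (M x x∈S─X))
    x∈S-mx = x∈p∧x≢y⇒x∈p-y (p─q⊆p S X x∈S─X) (adj⇒≢ t x~mx)

  feasible-pred : ∀ {k S} → Feasible t (suc k) S → GammaAtMost t k (suc ∣ S ∣)
  feasible-pred F = feasibleExcept⇒gammaAtMost (proj₂ (feasible-unmatch F))

  feasible-suc : ∀ {k S} → k < nTS t → Feasible t k S → GammaAtMost t (suc k) (suc ∣ S ∣)
  feasible-suc {S = S} k<n F@(dom , X , X⊆S∩TS , ∣X∣≡k , m , M)
    with ∣q∣<∣p∣⇒Nonempty[p─q] (TS t) X (subst (_< nTS t) (sym ∣X∣≡k) k<n)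
  ... | x , x∈TS─X with p─q⊆p (TS t) X x∈TS─X | x∈p─q⇒x∉q (TS t) X x∈TS─X | x ∈? S
  ... | x∈TS | _   | no x∉S  = S ∪ ⁅ x ⁆ , feasible-add-twin F x∈TS x∉S , ≤-reflexive (∣p∪⁅x⁆∣≡1+∣p∣ S x∉S)
  ... | x∈TS | x∉X | yes x∈S =
    feasibleExcept⇒gammaAtMost (partner-unmatched dom X⊆S∩TS ∣X∣≡k M x∈TS (x∈p∧x∉q⇒x∈p─q x∈S x∉X))

  gammaAtMost-mono : ∀ {k m m′} → m ≤ m′ → GammaAtMost t k m → GammaAtMost t k m′
  gammaAtMost-mono m≤m′ (S , F , ∣S∣≤m) = S , F , ≤-trans ∣S∣≤m m≤m′

  gammaAtMost-pred : ∀ {k m} → GammaAtMost t (suc k) m → GammaAtMost t k (suc m)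
  gammaAtMost-pred (S , F , ∣S∣≤m) = gammaAtMost-mono (s≤s ∣S∣≤m) (feasible-pred F)

  gammaAtMost-suc : ∀ {k m} → k < nTS t → GammaAtMost t k m → GammaAtMost t (suc k) (suc m)
  gammaAtMost-suc k<n (S , F , ∣S∣≤m) = gammaAtMost-mono (s≤s ∣S∣≤m) (feasible-suc k<n F)

2∣n⊎2∣1+n : ∀ n → (2 ∣ n) ⊎ (2 ∣ suc n)
2∣n⊎2∣1+n zero    = inj₁ (2 ∣0)
2∣n⊎2∣1+n (suc n) with 2∣n⊎2∣1+n n
... | inj₁ 2∣n   = inj₂ (∣m∣n⇒∣m+n n∣n 2∣n)
... | inj₂ 2∣1+n = inj₁ 2∣1+n

from-even-offsets : ∀ {P : ℕ → Set} {a b k} → (∀ i → 2 * i ≤ b ∸ a → P (a + 2 * i)) →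
  a ≤ k → k ≤ b → 2 ∣ k ∸ a → P k
from-even-offsets {P} {a} {b} {k} P-even a≤k k≤b (divides i k∸a≡i*2) =
  subst P a+2i≡k (P-even i (subst (_≤ b ∸ a) (sym 2i≡k∸a) (∸-monoˡ-≤ a k≤b)))
  where
  2i≡k∸a : 2 * i ≡ k ∸ a
  2i≡k∸a = trans (*-comm 2 i) (sym k∸a≡i*2)
  a+2i≡k : a + 2 * i ≡ k
  a+2i≡k = trans (cong (a +_) 2i≡k∸a) (m+[n∸m]≡n a≤k)

module _ (t : Tree) where

  feasible⇒gammaAtMost : ∀ {k S} → Feasible t k S → GammaAtMost t k ∣ S ∣
  feasible⇒gammaAtMost {S = S} F = S , F , ≤-refl

  isGamma⇒gammaAtMost : ∀ {k m} → IsGamma t k m → GammaAtMost t k m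
  isGamma⇒gammaAtMost ((S , F , ∣S∣≡m) , _) = S , F , ≤-reflexive ∣S∣≡m

  isGamma-minimal : ∀ {k m m′} → IsGamma t k m → GammaAtMost t k m′ → m ≤ m′
  isGamma-minimal (_ , minimal) (S , F , ∣S∣≤m′) = ≤-trans (minimal S F) ∣S∣≤m′

  isGamma : ∀ {k m} → GammaAtMost t k m → (∀ S → Feasible t k S → m ≤ ∣ S ∣) → IsGamma t k m
  isGamma (S , F , ∣S∣≤m) minimal = (S , F , ≤-antisym ∣S∣≤m (minimal S F)) , minimal

  isMinHat-unique : ∀ {μ μ′} → IsMinHat t μ → IsMinHat t μ′ → μ ≡ μ′
  isMinHat-unique ((k , k≤n , (S , F , ∣S∣≡μ) , _) , μ-minimal)
                  ((k′ , k′≤n , (S′ , F′ , ∣S′∣≡μ′) , _) , μ′-minimal) =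
    ≤-antisym (subst (_ ≤_) ∣S′∣≡μ′ (μ-minimal k′ k′≤n S′ F′)) (subst (_ ≤_) ∣S∣≡μ (μ′-minimal k k≤n S F))

  isAlphaHat⇒isGamma : ∀ {μ a} → IsMinHat t μ → IsAlphaHat t a → IsGamma t a μ
  isAlphaHat⇒isGamma isMin (_ , isMin′ , _ , γa , _) = subst (IsGamma t _) (isMinHat-unique isMin′ isMin) γa

  isBetaHat⇒isGamma : ∀ {μ b} → IsMinHat t μ → IsBetaHat t b → IsGamma t b μ
  isBetaHat⇒isGamma isMin (_ , isMin′ , _ , γb , _) = subst (IsGamma t _) (isMinHat-unique isMin′ isMin) γb

  gammaAtMost-descend : ∀ {k k′ m} → k ≤ k′ → GammaAtMost t k′ m → GammaAtMost t k (k′ ∸ k + m)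
  gammaAtMost-descend {k} {k′} {m} k≤k′ G =
    steps (k′ ∸ k) (subst (λ i → GammaAtMost t i m) (sym (m∸n+n≡m k≤k′)) G)
    where
    steps : ∀ d {m} → GammaAtMost t (d + k) m → GammaAtMost t k (d + m)
    steps zero    G = G
    steps (suc d) {m} G = subst (GammaAtMost t k) (+-suc d m) (steps d (gammaAtMost-pred t G))

  gammaAtMost-ascend : ∀ {k k′ m} → k ≤ k′ → k′ ≤ nTS t →
    GammaAtMost t k m → GammaAtMost t k′ (k′ ∸ k + m)
  gammaAtMost-ascend {k} {k′} {m} k≤k′ k′≤n G =
    subst (λ i → GammaAtMost t i (k′ ∸ k + m)) (m∸n+n≡m k≤k′)
      (steps (k′ ∸ k) (subst (_≤ nTS t) (sym (m∸n+n≡m k≤k′)) k′≤n))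
    where
    steps : ∀ d → d + k ≤ nTS t → GammaAtMost t (d + k) (d + m)
    steps zero    _      = G
    steps (suc d) d+k<n = gammaAtMost-suc t d+k<n (steps d (<⇒≤ d+k<n))

  feasible-parity : ∀ {k S} → Feasible t k S → ∃[ p ] (∣ S ∣ ≡ k + p × 2 ∣ p)
  feasible-parity {S = S} (_ , X , X⊆S∩TS , ∣X∣≡k , M) =
    ∣ S ─ X ∣ ,
    trans (∣p∣≡∣q∣+∣p─q∣ S X (proj₁ ∘ x∈p∩q⁻ S (TS t) ∘ X⊆S∩TS)) (cong (_+ ∣ S ─ X ∣) ∣X∣≡k) ,
    perfectMatching-even t M

  feasible-equal-size⇒2∣ : ∀ {k k′ S S′} → Feasible t k S → Feasible t k′ S′ → ∣ S ∣ ≡ ∣ S′ ∣ →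
    k′ ≤ k → 2 ∣ k ∸ k′
  feasible-equal-size⇒2∣ {k} {k′} {S} {S′} F F′ ∣S∣≡∣S′∣ k′≤k with feasible-parity F | feasible-parity F′
  ... | p , ∣S∣≡k+p , 2∣p | p′ , ∣S′∣≡k′+p′ , 2∣p′ = ∣m+n∣m⇒∣n (subst (2 ∣_) p′≡p+d 2∣p′) 2∣p
    where
    open ≡-Reasoning
    p′≡p+d : p′ ≡ p + (k ∸ k′)
    p′≡p+d = +-cancelˡ-≡ k′ _ _ (begin
      k′ + p′                ≡⟨ trans (sym ∣S′∣≡k′+p′) (trans (sym ∣S∣≡∣S′∣) ∣S∣≡k+p) ⟩
      k + p                  ≡⟨ cong (_+ p) (m+[n∸m]≡n k′≤k) ⟨
      k′ + (k ∸ k′) + p      ≡⟨ +-assoc k′ (k ∸ k′) p ⟩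
      k′ + ((k ∸ k′) + p)    ≡⟨ cong (k′ +_) (+-comm (k ∸ k′) p) ⟩
      k′ + (p + (k ∸ k′))    ∎)

  gamma-descending : ∀ {μ a k} → IsGamma t a μ → IsGamma t 0 (μ + a) → k ≤ a → IsGamma t k (μ + a ∸ k)
  gamma-descending {μ} {a} {k} γa γ₀ k≤a = isGamma upper lower
    where
    a∸k+μ≡μ+a∸k : a ∸ k + μ ≡ μ + a ∸ k
    a∸k+μ≡μ+a∸k = trans (+-comm (a ∸ k) μ) (sym (+-∸-assoc μ k≤a))
    upper : GammaAtMost t k (μ + a ∸ k)
    upper = subst (GammaAtMost t k) a∸k+μ≡μ+a∸k (gammaAtMost-descend k≤a (isGamma⇒gammaAtMost γa))
    lower : ∀ S → Feasible t k S → μ + a ∸ k ≤ ∣ S ∣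
    lower S F = m≤n+o⇒m∸n≤o (μ + a) k
      (isGamma-minimal γ₀ (gammaAtMost-descend z≤n (feasible⇒gammaAtMost F)))

  gamma-ascending : ∀ {μ b k} → k ≤ nTS t → IsGamma t b μ → IsGamma t (nTS t) (μ + nTS t ∸ b) →
    b ≤ k → IsGamma t k (μ + k ∸ b)
  gamma-ascending {μ} {b} {k} k≤n γb γₙ b≤k = isGamma upper lower
    where
    open ≡-Reasoning
    k∸b+μ≡μ+k∸b : k ∸ b + μ ≡ μ + k ∸ b
    k∸b+μ≡μ+k∸b = trans (+-comm (k ∸ b) μ) (sym (+-∸-assoc μ b≤k))
    upper : GammaAtMost t k (μ + k ∸ b)
    upper = subst (GammaAtMost t k) k∸b+μ≡μ+k∸b (gammaAtMost-ascend b≤k k≤n (isGamma⇒gammaAtMost γb))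
    μ+n∸b≡ : μ + nTS t ∸ b ≡ nTS t ∸ k + (μ + k ∸ b)
    μ+n∸b≡ = begin
      μ + nTS t ∸ b                ≡⟨ cong (λ i → μ + i ∸ b) (m+[n∸m]≡n k≤n) ⟨
      μ + (k + (nTS t ∸ k)) ∸ b    ≡⟨ cong (_∸ b) (+-assoc μ k (nTS t ∸ k)) ⟨
      μ + k + (nTS t ∸ k) ∸ b      ≡⟨ +-∸-comm (nTS t ∸ k) (≤-trans b≤k (m≤n+m k μ)) ⟩
      μ + k ∸ b + (nTS t ∸ k)      ≡⟨ +-comm (μ + k ∸ b) (nTS t ∸ k) ⟩
      nTS t ∸ k + (μ + k ∸ b)      ∎
    lower : ∀ S → Feasible t k S → μ + k ∸ b ≤ ∣ S ∣
    lower S F = +-cancelˡ-≤ (nTS t ∸ k) _ _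
      (subst (_≤ nTS t ∸ k + ∣ S ∣) μ+n∸b≡
        (isGamma-minimal γₙ (gammaAtMost-ascend k≤n ≤-refl (feasible⇒gammaAtMost F))))

  gamma-odd-gap : ∀ {μ a b k} → IsMinHat t μ → IsGamma t a μ →
    (∀ i → 2 * i ≤ b ∸ a → IsGamma t (a + 2 * i) μ) →
    k ≤ nTS t → a < k → k < b → ¬ 2 ∣ k ∸ a → IsGamma t k (suc μ)
  gamma-odd-gap {μ} {a} {b} {suc k} isMin γa γ-even 1+k≤n (s≤s a≤k) 1+k<b 2∤1+k∸a =
    isGamma (gammaAtMost-suc t 1+k≤n (isGamma⇒gammaAtMost γk)) lower
    where
    2∣k∸a : 2 ∣ k ∸ a
    2∣k∸a with 2∣n⊎2∣1+n (k ∸ a)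
    ... | inj₁ 2∣k∸a   = 2∣k∸a
    ... | inj₂ 2∣1+k∸a = contradiction (subst (2 ∣_) (sym (+-∸-assoc 1 a≤k)) 2∣1+k∸a) 2∤1+k∸a
    γk : IsGamma t k μ
    γk = from-even-offsets {P = λ i → IsGamma t i μ} γ-even a≤k (<⇒≤ (<-trans (n<1+n k) 1+k<b)) 2∣k∸a
    lower : ∀ S → Feasible t (suc k) S → suc μ ≤ ∣ S ∣
    lower S F = ≤∧≢⇒< (proj₂ isMin (suc k) 1+k≤n S F) μ≢∣S∣
      where
      μ≢∣S∣ : μ ≢ ∣ S ∣
      μ≢∣S∣ μ≡∣S∣ with proj₁ γa
      ... | Sa , Fa , ∣Sa∣≡μ =
        2∤1+k∸a (feasible-equal-size⇒2∣ F Fa (trans (sym μ≡∣S∣) (sym ∣Sa∣≡μ)) (m≤n⇒m≤1+n a≤k))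

corollary1 : (T : Tree) (ℓ : Label) (l r : Tree) → node ℓ l r ≼ T →
  let v = node ℓ l r in
  (μ a b : ℕ) → IsMinHat v μ → IsAlphaHat v a → IsBetaHat v b →
  IsGamma v 0 (μ + a) →
  IsGamma v (nTS v) (μ + nTS v ∸ b) →
  (∀ i → 2 * i ≤ b ∸ a → IsGamma v (a + 2 * i) μ) →
  ∀ k → k ≤ nTS v →
    (k ≤ a → IsGamma v k (μ + a ∸ k)) ×
    (b ≤ k → IsGamma v k (μ + k ∸ b)) ×
    (a < k → k < b → 2 ∣ (k ∸ a) → IsGamma v k μ) ×
    (a < k → k < b → ¬ (2 ∣ (k ∸ a)) → IsGamma v k (suc μ))
corollary1 T ℓ l r _ μ a b isMin α β γ₀ γₙ γ-even k k≤n =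
  gamma-descending v γa γ₀ ,
  gamma-ascending v k≤n γb γₙ ,
  (λ a<k k<b → from-even-offsets {P = λ i → IsGamma v i μ} γ-even (<⇒≤ a<k) (<⇒≤ k<b)) ,
  gamma-odd-gap v isMin γa γ-even k≤n
  where
  v = node ℓ l r
  γa = isAlphaHat⇒isGamma v isMin α
  γb = isBetaHat⇒isGamma v isMin β
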